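{- Let $A$ be a subdirectly irreducible MV-monoidal algebra and $(a_0,a_1,a_2,\dots)$ a good sequence in $A$. Then there exist $k\in\mathbb{N}$ and $x\in A$ such that $a_i=1$ for all $i<k$, $a_k=x$, and $a_i=0$ for all $i>k$; i.e. the sequence has the form $(1,\dots,1,x,0,0,\dots)$.
   Context: An MV-monoidal algebra is an algebra $\langle A;\oplus,\odot,\vee,\wedge,0,1\rangle$ (arities $2,2,2,2,0,0$) satisfying: $\langle A;\vee,\wedge\rangle$ is a distributive lattice; $\langle A;\oplus,0\rangle$ and $\langle A;\odot,1\rangle$ are commutative monoids; $\oplus$ and $\odot$ both distribute over both $\vee$ and $\wedge$; $(x\oplus y)\odot((x\odot y)\oplus z)=(x\odot(y\oplus z))\oplus(y\odot z)$; $(x\odot y)\oplus((x\oplus y)\odot z)=(x\oplus(y\odot z))\odot(y\oplus z)$; $(x\odot y)\oplus z=((x\oplus y)\odot((x\odot y)\oplus z))\vee z$; $(x\oplus y)\odot z=((x\odot y)\oplus((x\oplus y)\odot z))\wedge z$. A good pair in $A$ is a pair $(x_0,x_1)$ with $x_0\oplus x_1=x_0$ and $x_0\odot x_1=x_1$. A good sequence is a sequence $(a_0,a_1,\dots)$ of elements of $A$ which is eventually $0$ and such that $(a_n,a_{n+1})$ is a good pair for every $n\in\mathbb{N}$. Subdirect irreducibility is in the sense of universal algebra. -}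

module Defs where

open import Level using (0ℓ)
open import Data.Nat using (ℕ; _<_; _>_; _≥_)
open import Data.Product using (Σ; ∃; ∃-syntax; _×_; _,_)
open import Relation.Binary.PropositionalEquality using (_≡_)
open import Relation.Binary.Definitions using (Reflexive; Symmetric; Transitive)
open import Relation.Nullary using (¬_)
import Algebra.Structures as AS
import Algebra.Lattice.Structures as LS
import Algebra.Definitions as AD

record MVMonoidal : Set₁ where
  infixl 6 _⊕_
  infixl 7 _⊙_
  infixl 5 _∨_
  infixl 5 _∧_
  field
    Carrier : Set
    _⊕_ _⊙_ _∨_ _∧_ : Carrier → Carrier → Carrier
    𝟘 𝟙 : Carrier
    isDistributiveLattice : LS.IsDistributiveLattice _≡_ _∨_ _∧_
    ⊕-isCommutativeMonoid : AS.IsCommutativeMonoid _≡_ _⊕_ 𝟘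
    ⊙-isCommutativeMonoid : AS.IsCommutativeMonoid _≡_ _⊙_ 𝟙
    ⊕-distrib-∨ : AD._DistributesOver_ _≡_ _⊕_ _∨_
    ⊕-distrib-∧ : AD._DistributesOver_ _≡_ _⊕_ _∧_
    ⊙-distrib-∨ : AD._DistributesOver_ _≡_ _⊙_ _∨_
    ⊙-distrib-∧ : AD._DistributesOver_ _≡_ _⊙_ _∧_
    ax1 : ∀ x y z → (x ⊕ y) ⊙ ((x ⊙ y) ⊕ z) ≡ (x ⊙ (y ⊕ z)) ⊕ (y ⊙ z)
    ax2 : ∀ x y z → (x ⊙ y) ⊕ ((x ⊕ y) ⊙ z) ≡ (x ⊕ (y ⊙ z)) ⊙ (y ⊕ z)
    ax3 : ∀ x y z → (x ⊙ y) ⊕ z ≡ ((x ⊕ y) ⊙ ((x ⊙ y) ⊕ z)) ∨ z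
    ax4 : ∀ x y z → (x ⊕ y) ⊙ z ≡ ((x ⊙ y) ⊕ ((x ⊕ y) ⊙ z)) ∧ z

module _ (A : MVMonoidal) where
  open MVMonoidal A

  record IsCongruence (θ : Carrier → Carrier → Set) : Set where
    field
      refl′  : Reflexive θ
      sym′   : Symmetric θ
      trans′ : Transitive θ
      ⊕-cong : ∀ {x x′ y y′} → θ x x′ → θ y y′ → θ (x ⊕ y) (x′ ⊕ y′)
      ⊙-cong : ∀ {x x′ y y′} → θ x x′ → θ y y′ → θ (x ⊙ y) (x′ ⊙ y′)
      ∨-cong : ∀ {x x′ y y′} → θ x x′ → θ y y′ → θ (x ∨ y) (x′ ∨ y′)
      ∧-cong : ∀ {x x′ y y′} → θ x x′ → θ y y′ → θ (x ∧ y) (x′ ∧ y′)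

  IsDiagonal : (Carrier → Carrier → Set) → Set
  IsDiagonal θ = ∀ x y → θ x y → x ≡ y

  -- Subdirectly irreducible: A is nontrivial and Δ is completely
  -- meet-irreducible in Con A: whenever a family of congruences has
  -- intersection Δ, one of its members is Δ.
  SubdirectlyIrreducible : Set₁
  SubdirectlyIrreducible =
    (Σ Carrier λ x → Σ Carrier λ y → ¬ (x ≡ y)) ×
    ((I : Set) (θ : I → Carrier → Carrier → Set) →
      (∀ i → IsCongruence (θ i)) →
      IsDiagonal (λ x y → ∀ i → θ i x y) →
      Σ I (λ i → IsDiagonal (θ i)))

  GoodPair : Carrier → Carrier → Set
  GoodPair x₀ x₁ = (x₀ ⊕ x₁ ≡ x₀) × (x₀ ⊙ x₁ ≡ x₁)

  GoodSequence : (ℕ → Carrier) → Set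
  GoodSequence a = (∃[ N ] ∀ n → n ≥ N → a n ≡ 𝟘) × (∀ n → GoodPair (a n) (a (Data.Nat.suc n)))

{-# OPTIONS --safe #-}

-- For a good pair (x, y), the relations "u and v agree up to adding a multiple n·y" and
-- "u and v agree up to multiplying by a power xᵐ" are congruences, and they meet in the
-- identity: (xᵐ, n·y) is again a good pair, and for any good pair (x, y) the inequalities
-- u ≤ v ⊕ y and x ⊙ u ≤ v already force u ≤ v. In a subdirectly irreducible algebra one of
-- the two congruences is therefore the identity, which forces y = 0 or x = 1. Along a good
-- sequence each aₙ is thus 1 or followed by 0, and zeros propagate forward.
module Submission where

open import Defs
open import Axiom.ExcludedMiddle using (ExcludedMiddle)
open import Level using (0ℓ)
open import Data.Nat using (ℕ; _<_; _>_)
open import Data.Product using (Σ; ∃; ∃-syntax; _×_; _,_)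
open import Relation.Binary.PropositionalEquality using (_≡_)

open import Data.Bool using (Bool; true; false)
open import Data.Nat using (zero; suc; _+_; z≤n; s≤s; _≤′_; ≤′-refl; ≤′-step)
import Data.Nat as ℕ
import Data.Nat.Properties as ℕP
open import Data.Product using (proj₁; proj₂)
open import Data.Sum using (_⊎_; inj₁; inj₂)
open import Function using (_∘_)
open import Relation.Binary.Core using (_Preserves₂_⟶_⟶_)
open import Relation.Binary.PropositionalEquality using (refl; sym; trans; cong; cong₂; subst)
open import Algebra.Bundles using (CommutativeMonoid)
import Algebra.Definitions as AlgebraDefinitions
import Algebra.Lattice.Bundles as LB
import Algebra.Lattice.Structures as LS
import Algebra.Lattice.Properties.Lattice as LatticeProperties
import Algebra.Properties.CommutativeSemigroup as CommutativeSemigroupProperties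
import Algebra.Properties.Monoid.Mult as Mult
import Relation.Binary.Lattice as OrderLattice
import Relation.Binary.Lattice.Properties.JoinSemilattice as JoinProperties
import Relation.Binary.Lattice.Properties.MeetSemilattice as MeetProperties
import Relation.Binary.Reasoning.PartialOrder as PartialOrderReasoning

module MVMonoidalProperties (A : MVMonoidal) where
  open MVMonoidal A
  open AlgebraDefinitions {A = Carrier} _≡_ using (Commutative; _DistributesOverˡ_)
  open LS.IsDistributiveLattice isDistributiveLattice
    using (isLattice; ∧-comm; ∧-distribˡ-∨)

  ⊕-commutativeMonoid : CommutativeMonoid 0ℓ 0ℓ
  ⊕-commutativeMonoid = record { isCommutativeMonoid = ⊕-isCommutativeMonoid }

  ⊙-commutativeMonoid : CommutativeMonoid 0ℓ 0ℓ
  ⊙-commutativeMonoid = record { isCommutativeMonoid = ⊙-isCommutativeMonoid }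

  open CommutativeMonoid ⊕-commutativeMonoid using () renaming
    (assoc to ⊕-assoc; comm to ⊕-comm; identityˡ to ⊕-identityˡ; identityʳ to ⊕-identityʳ)
  open CommutativeMonoid ⊙-commutativeMonoid using () renaming
    (assoc to ⊙-assoc; comm to ⊙-comm; identityˡ to ⊙-identityˡ; identityʳ to ⊙-identityʳ)
  open CommutativeSemigroupProperties (CommutativeMonoid.commutativeSemigroup ⊕-commutativeMonoid)
    using () renaming (interchange to ⊕-interchange)
  open CommutativeSemigroupProperties (CommutativeMonoid.commutativeSemigroup ⊙-commutativeMonoid)
    using () renaming (interchange to ⊙-interchange)

  -- n ×⊕ y is the n-fold ⊕-multiple of y and n ×⊙ x the n-th ⊙-power of x.
  open Mult (CommutativeMonoid.monoid ⊕-commutativeMonoid)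
    using () renaming (_×_ to _×⊕_; ×-homo-+ to ×⊕-homo-+)
  open Mult (CommutativeMonoid.monoid ⊙-commutativeMonoid)
    using () renaming (_×_ to _×⊙_; ×-homo-+ to ×⊙-homo-+)

  lattice : LB.Lattice 0ℓ 0ℓ
  lattice = record { isLattice = isLattice }

  orderLattice : OrderLattice.Lattice 0ℓ 0ℓ 0ℓ
  orderLattice = LatticeProperties.∨-∧-orderTheoreticLattice lattice

  open OrderLattice.Lattice orderLattice
    using (_≤_; poset; joinSemilattice; meetSemilattice; x≤x∨y; y≤x∨y; ∨-least; x∧y≤x; x∧y≤y; ∧-greatest)
    renaming (refl to ≤-refl; reflexive to ≤-reflexive; trans to ≤-trans; antisym to ≤-antisym)
  open JoinProperties joinSemilattice using (∨-monotonic)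
  open MeetProperties meetSemilattice using (∧-monotonic)
  open PartialOrderReasoning poset

  module _ {_∙_ : Carrier → Carrier → Carrier}
           (∙-comm : Commutative _∙_) (∙-distribˡ-∧ : _∙_ DistributesOverˡ _∧_) where

    -- x ≤ y unfolds to x ≡ x ∧ y.
    distrib-∧⇒monoʳ : ∀ c {x y} → x ≤ y → c ∙ x ≤ c ∙ y
    distrib-∧⇒monoʳ c {x} {y} x≤y = trans (cong (c ∙_) x≤y) (∙-distribˡ-∧ c x y)

    distrib-∧⇒mono : _∙_ Preserves₂ _≤_ ⟶ _≤_ ⟶ _≤_
    distrib-∧⇒mono {x} {x′} {y} {y′} x≤x′ y≤y′ = begin
      x ∙ y   ≤⟨ distrib-∧⇒monoʳ x y≤y′ ⟩
      x ∙ y′  ≡⟨ ∙-comm x y′ ⟩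
      y′ ∙ x  ≤⟨ distrib-∧⇒monoʳ y′ x≤x′ ⟩
      y′ ∙ x′ ≡⟨ ∙-comm y′ x′ ⟩
      x′ ∙ y′ ∎

  ⊕-mono : _⊕_ Preserves₂ _≤_ ⟶ _≤_ ⟶ _≤_
  ⊕-mono = distrib-∧⇒mono ⊕-comm (proj₁ ⊕-distrib-∧)

  ⊙-mono : _⊙_ Preserves₂ _≤_ ⟶ _≤_ ⟶ _≤_
  ⊙-mono = distrib-∧⇒mono ⊙-comm (proj₁ ⊙-distrib-∧)

  𝟘≤ : ∀ x → 𝟘 ≤ x
  𝟘≤ x = begin
    𝟘                                       ≤⟨ y≤x∨y _ 𝟘 ⟩
    (x ⊕ 𝟙) ⊙ ((x ⊙ 𝟙) ⊕ 𝟘) ∨ 𝟘             ≡⟨ sym (ax3 x 𝟙 𝟘) ⟩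
    x ⊙ 𝟙 ⊕ 𝟘                               ≡⟨ trans (⊕-identityʳ _) (⊙-identityʳ x) ⟩
    x                                       ∎

  ≤𝟙 : ∀ x → x ≤ 𝟙
  ≤𝟙 x = begin
    x                                       ≡⟨ sym (trans (⊙-identityʳ _) (⊕-identityʳ x)) ⟩
    (x ⊕ 𝟘) ⊙ 𝟙                             ≡⟨ ax4 x 𝟘 𝟙 ⟩
    ((x ⊙ 𝟘) ⊕ ((x ⊕ 𝟘) ⊙ 𝟙)) ∧ 𝟙           ≤⟨ x∧y≤y _ 𝟙 ⟩
    𝟙                                       ∎

  x≤x⊕y : ∀ x y → x ≤ x ⊕ y
  x≤x⊕y x y = ≤-trans (≤-reflexive (sym (⊕-identityʳ x))) (⊕-mono ≤-refl (𝟘≤ y))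

  x⊙y≤x : ∀ x y → x ⊙ y ≤ x
  x⊙y≤x x y = ≤-trans (⊙-mono ≤-refl (≤𝟙 y)) (≤-reflexive (⊙-identityʳ x))

  x⊙[y⊕z]≤x⊙y⊕z : ∀ x y z → x ⊙ (y ⊕ z) ≤ x ⊙ y ⊕ z
  x⊙[y⊕z]≤x⊙y⊕z x y z = begin
    x ⊙ (y ⊕ z)                      ≤⟨ x≤x⊕y _ (y ⊙ z) ⟩
    x ⊙ (y ⊕ z) ⊕ y ⊙ z              ≡⟨ sym (ax1 x y z) ⟩
    (x ⊕ y) ⊙ ((x ⊙ y) ⊕ z)          ≤⟨ x≤x∨y _ z ⟩
    (x ⊕ y) ⊙ ((x ⊙ y) ⊕ z) ∨ z      ≡⟨ sym (ax3 x y z) ⟩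
    x ⊙ y ⊕ z                        ∎

  [a⊕b]⊙[c⊕d]≤a⊙c⊕b⊕d : ∀ a b c d → (a ⊕ b) ⊙ (c ⊕ d) ≤ a ⊙ c ⊕ b ⊕ d
  [a⊕b]⊙[c⊕d]≤a⊙c⊕b⊕d a b c d = begin
    (a ⊕ b) ⊙ (c ⊕ d)  ≤⟨ x⊙[y⊕z]≤x⊙y⊕z (a ⊕ b) c d ⟩
    (a ⊕ b) ⊙ c ⊕ d    ≡⟨ cong (_⊕ d) (⊙-comm (a ⊕ b) c) ⟩
    c ⊙ (a ⊕ b) ⊕ d    ≤⟨ ⊕-mono (x⊙[y⊕z]≤x⊙y⊕z c a b) ≤-refl ⟩
    c ⊙ a ⊕ b ⊕ d      ≡⟨ cong (λ t → t ⊕ b ⊕ d) (⊙-comm c a) ⟩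
    a ⊙ c ⊕ b ⊕ d      ∎

  [a⊙b]⊙[c⊕d]≤a⊙c⊕b⊙d : ∀ a b c d → (a ⊙ b) ⊙ (c ⊕ d) ≤ a ⊙ c ⊕ b ⊙ d
  [a⊙b]⊙[c⊕d]≤a⊙c⊕b⊙d a b c d = begin
    (a ⊙ b) ⊙ (c ⊕ d)  ≡⟨ trans (⊙-assoc a b _) (cong (λ t → a ⊙ (b ⊙ t)) (⊕-comm c d)) ⟩
    a ⊙ (b ⊙ (d ⊕ c))  ≤⟨ ⊙-mono ≤-refl (x⊙[y⊕z]≤x⊙y⊕z b d c) ⟩
    a ⊙ (b ⊙ d ⊕ c)    ≡⟨ cong (a ⊙_) (⊕-comm _ c) ⟩
    a ⊙ (c ⊕ b ⊙ d)    ≤⟨ x⊙[y⊕z]≤x⊙y⊕z a c (b ⊙ d) ⟩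
    a ⊙ c ⊕ b ⊙ d      ∎

  ×⊕-mono : ∀ y {m n} → m ℕ.≤ n → m ×⊕ y ≤ n ×⊕ y
  ×⊕-mono y z≤n       = 𝟘≤ _
  ×⊕-mono y (s≤s m≤n) = ⊕-mono ≤-refl (×⊕-mono y m≤n)

  ×⊙-antitone : ∀ x {m n} → m ℕ.≤ n → n ×⊙ x ≤ m ×⊙ x
  ×⊙-antitone x z≤n       = ≤𝟙 _
  ×⊙-antitone x (s≤s m≤n) = ⊙-mono ≤-refl (×⊙-antitone x m≤n)

  module _ {x y : Carrier} (good : GoodPair A x y) where
    private
      x⊕y≡x : x ⊕ y ≡ x
      x⊕y≡x = proj₁ good
      x⊙y≡y : x ⊙ y ≡ y
      x⊙y≡y = proj₂ good

    GoodPair⇒y⊕x⊙z≡x⊙[y⊕z] : ∀ z → y ⊕ x ⊙ z ≡ x ⊙ (y ⊕ z)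
    GoodPair⇒y⊕x⊙z≡x⊙[y⊕z] z = begin-equality
      y ⊕ x ⊙ z                  ≡⟨ cong₂ (λ s t → s ⊕ t ⊙ z) (sym x⊙y≡y) (sym x⊕y≡x) ⟩
      x ⊙ y ⊕ (x ⊕ y) ⊙ z        ≡⟨ ax2 x y z ⟩
      (x ⊕ y ⊙ z) ⊙ (y ⊕ z)      ≡⟨ cong (_⊙ (y ⊕ z)) x⊕y⊙z≡x ⟩
      x ⊙ (y ⊕ z)                ∎
      where
      x⊕y⊙z≡x : x ⊕ y ⊙ z ≡ x
      x⊕y⊙z≡x = ≤-antisym (≤-trans (⊕-mono ≤-refl (x⊙y≤x y z)) (≤-reflexive x⊕y≡x)) (x≤x⊕y x _)

    GoodPair⇒y⊕z≡x⊙[y⊕z]∨z : ∀ z → y ⊕ z ≡ x ⊙ (y ⊕ z) ∨ z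
    GoodPair⇒y⊕z≡x⊙[y⊕z]∨z z = begin-equality
      y ⊕ z                              ≡⟨ cong (_⊕ z) (sym x⊙y≡y) ⟩
      x ⊙ y ⊕ z                          ≡⟨ ax3 x y z ⟩
      (x ⊕ y) ⊙ (x ⊙ y ⊕ z) ∨ z          ≡⟨ cong₂ (λ s t → s ⊙ (t ⊕ z) ∨ z) x⊕y≡x x⊙y≡y ⟩
      x ⊙ (y ⊕ z) ∨ z                    ∎

    GoodPair⇒x⊙z≡[y⊕x⊙z]∧z : ∀ z → x ⊙ z ≡ (y ⊕ x ⊙ z) ∧ z
    GoodPair⇒x⊙z≡[y⊕x⊙z]∧z z = begin-equality
      x ⊙ z                              ≡⟨ cong (_⊙ z) (sym x⊕y≡x) ⟩
      (x ⊕ y) ⊙ z                        ≡⟨ ax4 x y z ⟩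
      (x ⊙ y ⊕ (x ⊕ y) ⊙ z) ∧ z          ≡⟨ cong₂ (λ s t → (s ⊕ t ⊙ z) ∧ z) x⊙y≡y x⊕y≡x ⟩
      (y ⊕ x ⊙ z) ∧ z                    ∎

    GoodPair-cancel : ∀ {u v} → u ≤ v ⊕ y → x ⊙ u ≤ v → u ≤ v
    GoodPair-cancel {u} {v} u≤v⊕y x⊙u≤v = begin
      u                                        ≤⟨ ∧-greatest ≤-refl u≤y⊕w ⟩
      u ∧ (y ⊕ w)                              ≡⟨ cong (u ∧_) (trans (GoodPair⇒y⊕z≡x⊙[y⊕z]∨z w)
                                                    (cong (_∨ w) (sym (GoodPair⇒y⊕x⊙z≡x⊙[y⊕z] w)))) ⟩
      u ∧ ((y ⊕ x ⊙ w) ∨ w)                    ≡⟨ ∧-distribˡ-∨ u _ w ⟩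
      (u ∧ (y ⊕ x ⊙ w)) ∨ (u ∧ w)              ≤⟨ ∨-monotonic u∧[y⊕x⊙w]≤x⊙u (x∧y≤y u w) ⟩
      x ⊙ u ∨ w                                ≤⟨ ∨-least x⊙u≤v (x∧y≤y u v) ⟩
      v                                        ∎
      where
      w = u ∧ v
      u≤y⊕w : u ≤ y ⊕ w
      u≤y⊕w = ≤-trans (∧-greatest (≤-trans (x≤x⊕y u y) (≤-reflexive (⊕-comm u y)))
                                  (≤-trans u≤v⊕y (≤-reflexive (⊕-comm v y))))
                      (≤-reflexive (sym (proj₁ ⊕-distrib-∧ y u v)))
      u∧[y⊕x⊙w]≤x⊙u : u ∧ (y ⊕ x ⊙ w) ≤ x ⊙ u
      u∧[y⊕x⊙w]≤x⊙u = begin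
        u ∧ (y ⊕ x ⊙ w)   ≤⟨ ∧-monotonic ≤-refl (⊕-mono ≤-refl (⊙-mono ≤-refl (x∧y≤x u v))) ⟩
        u ∧ (y ⊕ x ⊙ u)   ≡⟨ ∧-comm u _ ⟩
        (y ⊕ x ⊙ u) ∧ u   ≡⟨ sym (GoodPair⇒x⊙z≡[y⊕x⊙z]∧z u) ⟩
        x ⊙ u             ∎

  GoodPair-⊕ʳ : ∀ {x y y′} → GoodPair A x y → GoodPair A x y′ → GoodPair A x (y ⊕ y′)
  GoodPair-⊕ʳ {x} {y} {y′} good@(x⊕y≡x , _) (x⊕y′≡x , x⊙y′≡y′) =
    trans (sym (⊕-assoc x y y′)) (trans (cong (_⊕ y′) x⊕y≡x) x⊕y′≡x) ,
    trans (sym (GoodPair⇒y⊕x⊙z≡x⊙[y⊕z] good y′)) (cong (y ⊕_) x⊙y′≡y′)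

  GoodPair-⊙ˡ : ∀ {x x′ y} → GoodPair A x y → GoodPair A x′ y → GoodPair A (x ⊙ x′) y
  GoodPair-⊙ˡ {x} {x′} {y} good@(_ , x⊙y≡y) (x′⊕y≡x′ , x′⊙y≡y) =
    trans (⊕-comm (x ⊙ x′) y)
      (trans (GoodPair⇒y⊕x⊙z≡x⊙[y⊕z] good x′) (cong (x ⊙_) (trans (⊕-comm y x′) x′⊕y≡x′))) ,
    trans (⊙-assoc x x′ y) (trans (cong (x ⊙_) x′⊙y≡y) x⊙y≡y)

  GoodPair-𝟙ˡ : ∀ y → GoodPair A 𝟙 y
  GoodPair-𝟙ˡ y = ≤-antisym (≤𝟙 _) (x≤x⊕y 𝟙 y) , ⊙-identityˡ y

  GoodPair-𝟘ʳ : ∀ x → GoodPair A x 𝟘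
  GoodPair-𝟘ʳ x = ⊕-identityʳ x , ≤-antisym (≤-trans (≤-reflexive (⊙-comm x 𝟘)) (x⊙y≤x 𝟘 x)) (𝟘≤ _)

  GoodPair-×⊕ : ∀ {x y} → GoodPair A x y → ∀ n → GoodPair A x (n ×⊕ y)
  GoodPair-×⊕ good zero    = GoodPair-𝟘ʳ _
  GoodPair-×⊕ good (suc n) = GoodPair-⊕ʳ good (GoodPair-×⊕ good n)

  GoodPair-×⊙ : ∀ {x y} → GoodPair A x y → ∀ m → GoodPair A (m ×⊙ x) y
  GoodPair-×⊙ good zero    = GoodPair-𝟙ˡ _
  GoodPair-×⊙ good (suc m) = GoodPair-⊙ˡ good (GoodPair-×⊙ good m)

  record IsGradedCompatible (R : ℕ → Carrier → Carrier → Set) : Set where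
    field
      R-refl   : ∀ {u} → R 0 u u
      R-trans  : ∀ {m n u v w} → R m u v → R n v w → R (m + n) u w
      R-weaken : ∀ {m n u v} → m ℕ.≤ n → R m u v → R n u v
      R-⊕      : ∀ {m n u u′ v v′} → R m u v → R n u′ v′ → R (m + n) (u ⊕ u′) (v ⊕ v′)
      R-⊙      : ∀ {m n u u′ v v′} → R m u v → R n u′ v′ → R (m + n) (u ⊙ u′) (v ⊙ v′)
      R-∨      : ∀ {n u u′ v v′} → R n u v → R n u′ v′ → R n (u ∨ u′) (v ∨ v′)
      R-∧      : ∀ {n u u′ v v′} → R n u v → R n u′ v′ → R n (u ∧ u′) (v ∧ v′)

  Mutual : (ℕ → Carrier → Carrier → Set) → Carrier → Carrier → Set
  Mutual R u v = ∃[ n ] (R n u v × R n v u)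

  Mutual-isCongruence : ∀ {R} → IsGradedCompatible R → IsCongruence A (Mutual R)
  Mutual-isCongruence {R} isGraded = record
    { refl′  = 0 , R-refl , R-refl
    ; sym′   = λ (n , p , q) → n , q , p
    ; trans′ = λ (m , p , p′) (n , q , q′) →
        m + n , R-trans p q , R-weaken (ℕP.≤-reflexive (ℕP.+-comm n m)) (R-trans q′ p′)
    ; ⊕-cong = λ (m , p , p′) (n , q , q′) → m + n , R-⊕ p q , R-⊕ p′ q′
    ; ⊙-cong = λ (m , p , p′) (n , q , q′) → m + n , R-⊙ p q , R-⊙ p′ q′
    ; ∨-cong = λ (m , p , p′) (n , q , q′) → m + n ,
        R-∨ (weakenˡ p) (weakenʳ q) , R-∨ (weakenˡ p′) (weakenʳ q′)
    ; ∧-cong = λ (m , p , p′) (n , q , q′) → m + n ,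
        R-∧ (weakenˡ p) (weakenʳ q) , R-∧ (weakenˡ p′) (weakenʳ q′)
    }
    where
    open IsGradedCompatible isGraded
    weakenˡ : ∀ {m n u v} → R m u v → R (m + n) u v
    weakenˡ {m} {n} = R-weaken (ℕP.m≤m+n m n)
    weakenʳ : ∀ {m n u v} → R n u v → R (m + n) u v
    weakenʳ {m} {n} = R-weaken (ℕP.m≤n+m n m)

  UpToMultiple : Carrier → ℕ → Carrier → Carrier → Set
  UpToMultiple y n u v = u ≤ v ⊕ n ×⊕ y

  UpToPower : Carrier → ℕ → Carrier → Carrier → Set
  UpToPower x n u v = n ×⊙ x ⊙ u ≤ v

  UpToMultiple-isGradedCompatible : ∀ y → IsGradedCompatible (UpToMultiple y)
  UpToMultiple-isGradedCompatible y = record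
    { R-refl   = x≤x⊕y _ 𝟘
    ; R-trans  = λ {m} {n} → trans′ {m} {n}
    ; R-weaken = λ m≤n p → ≤-trans p (⊕-mono ≤-refl (×⊕-mono y m≤n))
    ; R-⊕      = λ {m} {n} → ⊕′ {m} {n}
    ; R-⊙      = λ {m} {n} → ⊙′ {m} {n}
    ; R-∨      = λ p q → ≤-trans (∨-monotonic p q) (≤-reflexive (sym (proj₂ ⊕-distrib-∨ _ _ _)))
    ; R-∧      = λ p q → ≤-trans (∧-monotonic p q) (≤-reflexive (sym (proj₂ ⊕-distrib-∧ _ _ _)))
    }
    where
    ×⊕-split : ∀ v m n → v ⊕ m ×⊕ y ⊕ n ×⊕ y ≡ v ⊕ (m + n) ×⊕ y
    ×⊕-split v m n = trans (⊕-assoc v _ _) (cong (v ⊕_) (sym (×⊕-homo-+ y m n)))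

    trans′ : ∀ {m n u v w} → UpToMultiple y m u v → UpToMultiple y n v w → UpToMultiple y (m + n) u w
    trans′ {m} {n} {u} {v} {w} p q = begin
      u                          ≤⟨ p ⟩
      v ⊕ m ×⊕ y                 ≤⟨ ⊕-mono q ≤-refl ⟩
      w ⊕ n ×⊕ y ⊕ m ×⊕ y        ≡⟨ ⊕-assoc w _ _ ⟩
      w ⊕ (n ×⊕ y ⊕ m ×⊕ y)      ≡⟨ cong (w ⊕_) (⊕-comm _ _) ⟩
      w ⊕ (m ×⊕ y ⊕ n ×⊕ y)      ≡⟨ sym (⊕-assoc w _ _) ⟩
      w ⊕ m ×⊕ y ⊕ n ×⊕ y        ≡⟨ ×⊕-split w m n ⟩
      w ⊕ (m + n) ×⊕ y           ∎

    ⊕′ : ∀ {m n u u′ v v′} → UpToMultiple y m u v → UpToMultiple y n u′ v′ →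
         UpToMultiple y (m + n) (u ⊕ u′) (v ⊕ v′)
    ⊕′ {m} {n} {u} {u′} {v} {v′} p q = begin
      u ⊕ u′                          ≤⟨ ⊕-mono p q ⟩
      (v ⊕ m ×⊕ y) ⊕ (v′ ⊕ n ×⊕ y)    ≡⟨ ⊕-interchange v _ v′ _ ⟩
      (v ⊕ v′) ⊕ (m ×⊕ y ⊕ n ×⊕ y)    ≡⟨ sym (⊕-assoc (v ⊕ v′) _ _) ⟩
      v ⊕ v′ ⊕ m ×⊕ y ⊕ n ×⊕ y        ≡⟨ ×⊕-split (v ⊕ v′) m n ⟩
      v ⊕ v′ ⊕ (m + n) ×⊕ y           ∎

    ⊙′ : ∀ {m n u u′ v v′} → UpToMultiple y m u v → UpToMultiple y n u′ v′ →
         UpToMultiple y (m + n) (u ⊙ u′) (v ⊙ v′)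
    ⊙′ {m} {n} {u} {u′} {v} {v′} p q = begin
      u ⊙ u′                          ≤⟨ ⊙-mono p q ⟩
      (v ⊕ m ×⊕ y) ⊙ (v′ ⊕ n ×⊕ y)    ≤⟨ [a⊕b]⊙[c⊕d]≤a⊙c⊕b⊕d v _ v′ _ ⟩
      v ⊙ v′ ⊕ m ×⊕ y ⊕ n ×⊕ y        ≡⟨ ×⊕-split (v ⊙ v′) m n ⟩
      v ⊙ v′ ⊕ (m + n) ×⊕ y           ∎

  UpToPower-isGradedCompatible : ∀ x → IsGradedCompatible (UpToPower x)
  UpToPower-isGradedCompatible x = record
    { R-refl   = ≤-reflexive (⊙-identityˡ _)
    ; R-trans  = λ {m} {n} → trans′ {m} {n}
    ; R-weaken = λ m≤n p → ≤-trans (⊙-mono (×⊙-antitone x m≤n) ≤-refl) p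
    ; R-⊕      = λ {m} {n} {u} {u′} p q → begin
        (m + n) ×⊙ x ⊙ (u ⊕ u′)             ≡⟨ cong (_⊙ (u ⊕ u′)) (×⊙-homo-+ x m n) ⟩
        (m ×⊙ x ⊙ n ×⊙ x) ⊙ (u ⊕ u′)        ≤⟨ [a⊙b]⊙[c⊕d]≤a⊙c⊕b⊙d _ _ u u′ ⟩
        m ×⊙ x ⊙ u ⊕ n ×⊙ x ⊙ u′            ≤⟨ ⊕-mono p q ⟩
        _                                   ∎
    ; R-⊙      = λ {m} {n} {u} {u′} p q → begin
        (m + n) ×⊙ x ⊙ (u ⊙ u′)             ≡⟨ cong (_⊙ (u ⊙ u′)) (×⊙-homo-+ x m n) ⟩
        (m ×⊙ x ⊙ n ×⊙ x) ⊙ (u ⊙ u′)        ≡⟨ ⊙-interchange _ _ u u′ ⟩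
        m ×⊙ x ⊙ u ⊙ (n ×⊙ x ⊙ u′)          ≤⟨ ⊙-mono p q ⟩
        _                                   ∎
    ; R-∨      = λ p q → ≤-trans (≤-reflexive (proj₁ ⊙-distrib-∨ _ _ _)) (∨-monotonic p q)
    ; R-∧      = λ p q → ≤-trans (≤-reflexive (proj₁ ⊙-distrib-∧ _ _ _)) (∧-monotonic p q)
    }
    where
    trans′ : ∀ {m n u v w} → UpToPower x m u v → UpToPower x n v w → UpToPower x (m + n) u w
    trans′ {m} {n} {u} {v} {w} p q = begin
      (m + n) ×⊙ x ⊙ u              ≡⟨ cong (_⊙ u) (trans (×⊙-homo-+ x m n) (⊙-comm _ _)) ⟩
      n ×⊙ x ⊙ m ×⊙ x ⊙ u           ≡⟨ ⊙-assoc _ _ u ⟩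
      n ×⊙ x ⊙ (m ×⊙ x ⊙ u)         ≤⟨ ⊙-mono ≤-refl p ⟩
      n ×⊙ x ⊙ v                    ≤⟨ q ⟩
      w                             ∎

  GoodPair-dichotomy : SubdirectlyIrreducible A → ∀ {x y} → GoodPair A x y → x ≡ 𝟙 ⊎ y ≡ 𝟘
  GoodPair-dichotomy (_ , irreducible) {x} {y} good =
    conclude (irreducible Bool θ θ-isCongruence θ-meet-diagonal)
    where
    θ : Bool → Carrier → Carrier → Set
    θ true  = Mutual (UpToMultiple y)
    θ false = Mutual (UpToPower x)

    θ-isCongruence : ∀ b → IsCongruence A (θ b)
    θ-isCongruence true  = Mutual-isCongruence (UpToMultiple-isGradedCompatible y)
    θ-isCongruence false = Mutual-isCongruence (UpToPower-isGradedCompatible x)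

    θ-meet-diagonal : IsDiagonal A (λ u v → ∀ b → θ b u v)
    θ-meet-diagonal u v θuv with θuv true | θuv false
    ... | n , u≤v⊕ny , v≤u⊕ny | m , xᵐu≤v , xᵐv≤u =
      ≤-antisym (GoodPair-cancel power-multiple u≤v⊕ny xᵐu≤v) (GoodPair-cancel power-multiple v≤u⊕ny xᵐv≤u)
      where power-multiple = GoodPair-×⊕ (GoodPair-×⊙ good m) n

    conclude : Σ Bool (λ b → IsDiagonal A (θ b)) → x ≡ 𝟙 ⊎ y ≡ 𝟘
    conclude (true  , diagonal) =
      inj₂ (diagonal y 𝟘 (1 , ≤-reflexive (sym (trans (⊕-identityˡ _) (⊕-identityʳ y))) , 𝟘≤ _))
    conclude (false , diagonal) =
      inj₁ (diagonal x 𝟙 (1 , ≤𝟙 _ , ≤-reflexive (trans (⊙-identityʳ _) (⊙-identityʳ x))))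

  GoodPair-𝟘ˡ : ∀ {y} → GoodPair A 𝟘 y → y ≡ 𝟘
  GoodPair-𝟘ˡ {y} (𝟘⊕y≡𝟘 , _) = trans (sym (⊕-identityˡ y)) 𝟘⊕y≡𝟘

  𝟘-propagates : ∀ {a : ℕ → Carrier} → (∀ n → GoodPair A (a n) (a (suc n))) → ∀ n → a n ≡ 𝟘 → a (suc n) ≡ 𝟘
  𝟘-propagates {a} good n aₙ≡𝟘 = GoodPair-𝟘ˡ (subst (λ t → GoodPair A t (a (suc n))) aₙ≡𝟘 (good n))

prefixUntil : ∀ {P Q : ℕ → Set} → (∀ n → P n ⊎ Q (suc n)) →
              ∀ N → Q (suc N) → ∃[ k ] ((∀ i → i < k → P i) × Q (suc k))
prefixUntil step zero    q = 0 , (λ _ ()) , q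
prefixUntil {P} {Q} step (suc N) q with step 0
... | inj₂ q₁ = 0 , (λ _ ()) , q₁
... | inj₁ p₀ with prefixUntil {P ∘ suc} {Q ∘ suc} (step ∘ suc) N q
...   | k , ps , qk = suc k , prefix , qk
  where
  prefix : ∀ i → i < suc k → P i
  prefix zero    _         = p₀
  prefix (suc i) (s≤s i<k) = ps i i<k

suc-closed⇒≤-closed : ∀ {Q : ℕ → Set} → (∀ n → Q n → Q (suc n)) → ∀ {m n} → m ℕ.≤ n → Q m → Q n
suc-closed⇒≤-closed {Q} step m≤n = go (ℕP.≤⇒≤′ m≤n)
  where
  go : ∀ {m n} → m ≤′ n → Q m → Q n
  go ≤′-refl        q = q
  go (≤′-step m≤′n) q = step _ (go m≤′n q)

corollaryC6 : ExcludedMiddle 0ℓ → (A : MVMonoidal) → SubdirectlyIrreducible A →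
    (a : ℕ → MVMonoidal.Carrier A) → GoodSequence A a →
    ∃[ k ] ∃[ x ] ((∀ i → i < k → a i ≡ MVMonoidal.𝟙 A) × (a k ≡ x) × (∀ i → i > k → a i ≡ MVMonoidal.𝟘 A))
corollaryC6 _ A irreducible a ((N , eventually𝟘) , good) =
  let k , ones , a[1+k]≡𝟘 = prefixUntil {Q = λ n → a n ≡ 𝟘} (λ n → GoodPair-dichotomy irreducible (good n))
                                          N (eventually𝟘 (suc N) (ℕP.n≤1+n N))
  in  k , a k , ones , refl , λ i k<i → suc-closed⇒≤-closed (𝟘-propagates good) k<i a[1+k]≡𝟘
  where
  open MVMonoidal A using (𝟘)
  open MVMonoidalProperties A using (GoodPair-dichotomy; 𝟘-propagates)
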